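{- Let $t\geq 4$, let $G$ be a connected $K^2_t$-saturated graph of order $n$, and let $V_1=\{v_1,\dots,v_t\}\subset V(G)$ with $G[V_1]\cong K_t$. Then one of the following holds: (i) there exists $i\in\{1,\dots,t\}$ such that $v_i$ is a cut vertex of $G$ and $d(v_j)=t-1$ for all $j\in\{1,\dots,t\}\setminus\{i\}$; (ii) there exist distinct $i,j\in\{1,\dots,t\}$ such that $d(v_i)=d(v_j)=t-1$ and $d(v_k)=t$ for all $k\in\{1,\dots,t\}\setminus\{i,j\}$, with some vertex $v\in V(G)\setminus V_1$ satisfying $vv_k\in E(G)$ for these $k$.
   Context: All graphs are finite and simple; $d(v)$ denotes the degree of $v$ in $G$ and $G[U]$ is the induced subgraph on $U$. For $t\ge 3$, the virus $K^2_t$ is the graph on $t+2$ vertices obtained from the complete graph $K_t$ by attaching one pendant vertex to each of two distinct vertices of $K_t$. A graph $G$ is $K^2_t$-saturated if it contains no subgraph isomorphic to $K^2_t$ but $G+uv$ contains one for every pair of non-adjacent vertices $u,v$; by convention a graph with fewer than $t+2$ vertices is not $K^2_t$-saturated. -}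

module Defs where

open import Data.Nat using (ℕ; suc; _+_; _≤_)
open import Data.Fin using (Fin)
open import Data.Bool using (Bool; true; false)
open import Data.Bool.Properties using () renaming (_≟_ to _≟ᵇ_)
open import Data.List using (List; length; filter; allFin)
open import Data.Product using (Σ; _×_; _,_; ∃; ∃-syntax)
open import Data.Sum using (_⊎_)
open import Relation.Nullary using (¬_)
open import Relation.Binary.PropositionalEquality using (_≡_; _≢_)
open import Function.Definitions using (Injective)

record Graph (n : ℕ) : Set where
  field
    adj    : Fin n → Fin n → Bool
    sym    : ∀ u v → adj u v ≡ adj v u
    irrefl : ∀ v → adj v v ≡ false

open Graph public

E : ∀ {n} → Graph n → Fin n → Fin n → Set
E G u v = adj G u v ≡ true

degree : ∀ {n} → Graph n → Fin n → ℕ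
degree {n} G v = length (filter (λ u → adj G v u ≟ᵇ true) (allFin n))

E+ : ∀ {n} → Graph n → Fin n → Fin n → Fin n → Fin n → Set
E+ G u v x y = E G x y ⊎ ((x ≡ u × y ≡ v) ⊎ (x ≡ v × y ≡ u))

-- A (symmetric) edge relation R on Fin n contains a subgraph isomorphic to
-- the virus K^2_t: an injective map f : Fin t → Fin n whose image spans K_t
-- (all distinct pairs adjacent), two distinct vertices p, q outside the image,
-- and distinct indices a, b with p adjacent to f a and q adjacent to f b.
ContainsVirus : ∀ {n} → ℕ → (Fin n → Fin n → Set) → Set
ContainsVirus {n} t R =
  Σ (Fin t → Fin n) λ f →
    Injective _≡_ _≡_ f
  × (∀ i j → i ≢ j → R (f i) (f j))
  × Σ (Fin n) λ p → Σ (Fin n) λ q → Σ (Fin t) λ a → Σ (Fin t) λ b →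
      p ≢ q × a ≢ b
    × (∀ i → f i ≢ p) × (∀ i → f i ≢ q)
    × R p (f a) × R q (f b)

-- K^2_t-saturated (graphs with fewer than t+2 vertices are not saturated)
Saturated : ∀ {n} → ℕ → Graph n → Set
Saturated {n} t G =
    t + 2 ≤ n
  × ¬ ContainsVirus t (E G)
  × (∀ u v → u ≢ v → ¬ E G u v → ContainsVirus t (E+ G u v))

data Walk {n} (G : Graph n) (P : Fin n → Set) : Fin n → Fin n → Set where
  here : ∀ {x} → P x → Walk G P x x
  step : ∀ {x y z} → P x → E G x y → Walk G P y z → Walk G P x z

AnyVertex : ∀ {n} → Fin n → Set
AnyVertex _ = Data.Unit.⊤
  where import Data.Unit

Connected : ∀ {n} → Graph n → Set
Connected G = ∀ x y → Walk G AnyVertex x y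

-- v is a cut vertex: deleting v increases the number of components, i.e.
-- some x, y ≠ v are joined by a walk in G but by none in G - v.
CutVertex : ∀ {n} → Graph n → Fin n → Set
CutVertex G v = Σ _ λ x → Σ _ λ y →
  x ≢ v × y ≢ v × Walk G AnyVertex x y × ¬ Walk G (λ w → w ≢ v) x y

-- Two vertices of K = {v₁,…,vₜ} with distinct neighbours outside K carry a virus, so either all
-- outside neighbours of K hang at a single vᵢ, which then separates them from the rest of K, or
-- they are one vertex w. In the second case w misses at least two vertices of K: otherwise w can
-- replace the missed one in K, and a vertex behind w (which exists by connectivity and n ≥ t + 2)
-- gives a virus. And w misses exactly two: if it missed v_c, v_d, v_e, then G + w v_c would still
-- be virus-free.

module Submission where

open import Defs hiding (sym)
open import Data.Nat using (ℕ; zero; suc; _≤_; _<_; _+_; _∸_; s≤s)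
open import Data.Nat.Properties using (<⇒≱; <⇒≤; n≮n; +-comm)
open import Data.Fin using (Fin; zero; suc; punchIn; punchOut; _≟_)
open import Data.Fin.Properties
  using (any?; all?; injective⇒≤; suc-injective; punchIn-injective; punchInᵢ≢i; punchOut-injective; punchIn-punchOut)
open import Data.Vec.Functional using (_∷_)
open import Data.Bool using (true)
open import Data.Bool.Properties using () renaming (_≟_ to _≟ᵇ_)
open import Data.List using (length; filter; allFin; tabulate)
open import Data.List.Properties using (length-tabulate)
open import Data.List.Membership.Propositional using (_∈_)
open import Data.List.Membership.Propositional.Properties
  using (∈-filter⁺; ∈-filter⁻; ∈-allFin; ∈-tabulate⁺; ∈-tabulate⁻)
open import Data.List.Membership.Propositional.Properties.WithK using (unique∧set⇒bag)
open import Data.List.Relation.Unary.Unique.Propositional.Properties using (filter⁺; allFin⁺; tabulate⁺)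
open import Data.List.Relation.Binary.BagAndSetEquality using (_∼[_]_; set; ∼bag⇒↭)
open import Data.List.Relation.Binary.Permutation.Propositional.Properties using (↭-length)
open import Data.Product using (Σ; ∃; ∃₂; _×_; _,_; proj₁; proj₂; curry; uncurry)
open import Data.Sum using (_⊎_; inj₁; inj₂; [_,_]′)
import Data.Sum as Sum
open import Data.Empty using (⊥; ⊥-elim)
open import Function using (_∘_; id)
open import Function.Bundles using (mk⇔)
open import Function.Definitions using (Injective)
open import Relation.Nullary using (¬_; yes; no; ¬?; contradiction)
open import Relation.Nullary.Decidable using (_×-dec_; decidable-stable)
open import Relation.Unary using (Decidable)
open import Relation.Binary.PropositionalEquality using (_≡_; _≢_; refl; sym; trans; cong; subst; subst₂; module ≡-Reasoning)

factor-injective : ∀ {a b c} {A : Set a} {B : Set b} {C : Set c} {f : A → C} (g : B → C) {ψ : A → B} →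
  (∀ x → g (ψ x) ≡ f x) → Injective _≡_ _≡_ f → Injective _≡_ _≡_ ψ
factor-injective g factors f-inj {x} {y} ψx≡ψy = f-inj (trans (sym (factors x)) (trans (cong g ψx≡ψy) (factors y)))

injective-avoiding⇒< : ∀ {m n} {g : Fin m → Fin n} {e : Fin n} → Injective _≡_ _≡_ g → (∀ k → g k ≢ e) → m < n
injective-avoiding⇒< {n = suc n} g-inj avoids =
  s≤s (injective⇒≤ {f = λ k → punchOut (avoids k ∘ sym)}
    (g-inj ∘ punchOut-injective (avoids _ ∘ sym) (avoids _ ∘ sym)))

injective-into-image-avoiding⇒< : ∀ {a} {A : Set a} {m k} {f : Fin m → A} (g : Fin k → A) {e : Fin k} →
  Injective _≡_ _≡_ f → (∀ γ → ∃ λ κ → κ ≢ e × g κ ≡ f γ) → m < k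
injective-into-image-avoiding⇒< g f-inj preimage =
  injective-avoiding⇒< (factor-injective g (proj₂ ∘ proj₂ ∘ preimage) f-inj) (proj₁ ∘ proj₂ ∘ preimage)

<⇒∃-unhit : ∀ {m n} (g : Fin m → Fin n) → m < n → ∃ λ u → ∀ k → g k ≢ u
<⇒∃-unhit g m<n with any? (λ u → all? (λ k → ¬? (g k ≟ u)))
... | yes unhit = unhit
... | no ¬unhit = contradiction (injective⇒≤ (factor-injective g (proj₂ ∘ preimage) id)) (<⇒≱ m<n)
  where
  preimage : ∀ u → ∃ λ k → g k ≡ u
  preimage u with any? (λ k → g k ≟ u)
  ... | yes hit = hit
  ... | no ¬hit = contradiction (u , curry ¬hit) ¬unhit

two-counterexamples : ∀ {m p} {P : Fin (suc m) → Set p} → Decidable P →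
  (∀ c → ¬ (∀ k → k ≢ c → P k)) → ∃₂ λ c d → c ≢ d × ¬ P c × ¬ P d
two-counterexamples P? ¬almost-all with any? (¬? ∘ P?)
... | no ∄¬P = ⊥-elim (¬almost-all zero λ k _ → decidable-stable (P? k) (curry ∄¬P k))
... | yes (c , ¬Pc) with any? (λ d → ¬? (d ≟ c) ×-dec ¬? (P? d))
...   | yes (d , d≢c , ¬Pd) = c , d , d≢c ∘ sym , ¬Pc , ¬Pd
...   | no ∄d = ⊥-elim (¬almost-all c λ k k≢c → decidable-stable (P? k) (curry (curry ∄d k) k≢c))

module _ {n} (G : Graph n) where

  E-sym : ∀ {x y} → E G x y → E G y x
  E-sym {x} {y} = trans (Graph.sym G y x)

  E-irrefl : ∀ {x} → ¬ E G x x
  E-irrefl {x} xx = contradiction (trans (sym (irrefl G x)) xx) λ ()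

  degree-via-enumeration : ∀ {m} (x : Fin n) (g : Fin m → Fin n) → Injective _≡_ _≡_ g →
    (∀ k → E G x (g k)) → (∀ u → E G x u → ∃ λ k → g k ≡ u) → degree G x ≡ m
  degree-via-enumeration {m} x g g-inj g-adjacent g-onto = begin
    length (filter P? (allFin n)) ≡⟨ ↭-length (∼bag⇒↭ (unique∧set⇒bag
                                      (filter⁺ P? (allFin⁺ n)) (tabulate⁺ g-inj) same-members)) ⟩
    length (tabulate g)           ≡⟨ length-tabulate g ⟩
    m                             ∎
    where
    open ≡-Reasoning
    P? : Decidable (E G x)
    P? u = adj G x u ≟ᵇ true
    same-members : filter P? (allFin n) ∼[ set ] tabulate g
    same-members = mk⇔ to from
      where
      to : ∀ {u} → u ∈ filter P? (allFin n) → u ∈ tabulate g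
      to {u} u∈ with g-onto u (proj₂ (∈-filter⁻ P? {xs = allFin n} u∈))
      ... | k , refl = ∈-tabulate⁺ k
      from : ∀ {u} → u ∈ tabulate g → u ∈ filter P? (allFin n)
      from u∈ with ∈-tabulate⁻ u∈
      ... | k , refl = ∈-filter⁺ P? (∈-allFin (g k)) (g-adjacent k)

  walk-start : ∀ {P x y} → Walk G P x y → P x
  walk-start (here Px) = Px
  walk-start (step Px _ _) = Px

  walk-exit : ∀ {P Q : Fin n → Set} → Decidable Q → ∀ {x y} → Walk G P x y → Q x → ¬ Q y →
    ∃₂ λ a b → P b × Q a × ¬ Q b × E G a b
  walk-exit Q? (here _) Qx ¬Qy = contradiction Qx ¬Qy
  walk-exit Q? (step {y = z} _ xz walk) Qx ¬Qy with Q? z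
  ... | yes Qz = walk-exit Q? walk Qz ¬Qy
  ... | no ¬Qz = _ , z , walk-start walk , Qx , ¬Qz , xz

  E+-old : ∀ {u v x y} → x ≢ u → x ≢ v → E+ G u v x y → E G x y
  E+-old _ _ (inj₁ xy) = xy
  E+-old x≢u _ (inj₂ (inj₁ (x≡u , _))) = contradiction x≡u x≢u
  E+-old _ x≢v (inj₂ (inj₂ (x≡v , _))) = contradiction x≡v x≢v

module Clique {m n} (G : Graph n) (v : Fin (2 + m) → Fin n) (v-injective : Injective _≡_ _≡_ v)
  (v-clique : ∀ i j → i ≢ j → E G (v i) (v j)) (virus-free : ¬ ContainsVirus (2 + m) (E G)) where

  InK : Fin n → Set
  InK u = ∃ λ k → v k ≡ u

  InK? : Decidable InK
  InK? u = any? (λ k → v k ≟ u)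

  Outer : Fin (2 + m) → Fin n → Set
  Outer k u = E G (v k) u × ¬ InK u

  Outer? : ∀ k → Decidable (Outer k)
  Outer? k u = (adj G (v k) u ≟ᵇ true) ×-dec ¬? (InK? u)

  outer-unique : ∀ {a b p q} → a ≢ b → Outer a p → Outer b q → p ≡ q
  outer-unique {a} {b} {p} {q} a≢b (ap , p∉K) (bq , q∉K) with p ≟ q
  ... | yes p≡q = p≡q
  ... | no p≢q = contradiction
    (v , (λ {_} {_} → v-injective) , v-clique , p , q , a , b , p≢q , a≢b , curry p∉K , curry q∉K , E-sym G ap , E-sym G bq)
    virus-free

  adjacent-punchIn : ∀ j k → E G (v j) (v (punchIn j k))
  adjacent-punchIn j k = v-clique j (punchIn j k) (punchInᵢ≢i j k ∘ sym)

  clique-neighbour : ∀ j u → E G (v j) u → Outer j u ⊎ ∃ λ k → v (punchIn j k) ≡ u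
  clique-neighbour j u ju with InK? u
  ... | no u∉K = inj₁ (ju , u∉K)
  ... | yes (k , refl) with j ≟ k
  ...   | yes refl = ⊥-elim (E-irrefl G ju)
  ...   | no j≢k = inj₂ (punchOut j≢k , cong v (punchIn-punchOut j≢k))

  degree-without-outer : ∀ j → (∀ u → ¬ Outer j u) → degree G (v j) ≡ suc m
  degree-without-outer j no-outer =
    degree-via-enumeration G (v j) (v ∘ punchIn j) (punchIn-injective j _ _ ∘ v-injective) (adjacent-punchIn j)
      (λ u ju → [ ⊥-elim ∘ no-outer u , id ]′ (clique-neighbour j u ju))

  K[_≔_] : Fin (2 + m) → Fin n → Fin (2 + m) → Fin n
  K[ j ≔ w ] = w ∷ v ∘ punchIn j

  K[≔]-injective : ∀ j {w} → ¬ InK w → Injective _≡_ _≡_ K[ j ≔ w ]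
  K[≔]-injective j w∉K {zero} {zero} _ = refl
  K[≔]-injective j w∉K {zero} {suc l} w≡ = contradiction (punchIn j l , sym w≡) w∉K
  K[≔]-injective j w∉K {suc k} {zero} ≡w = contradiction (punchIn j k , ≡w) w∉K
  K[≔]-injective j w∉K {suc k} {suc l} eq = cong suc (punchIn-injective j k l (v-injective eq))

  degree-single-outer : ∀ j w → Outer j w → (∀ u → Outer j u → u ≡ w) → degree G (v j) ≡ 2 + m
  degree-single-outer j w (jw , w∉K) outer⇒w =
    degree-via-enumeration G (v j) K[ j ≔ w ] (K[≔]-injective j w∉K) adjacent onto
    where
    adjacent : ∀ k → E G (v j) (K[ j ≔ w ] k)
    adjacent zero = jw
    adjacent (suc k) = adjacent-punchIn j k
    onto : ∀ u → E G (v j) u → ∃ λ k → K[ j ≔ w ] k ≡ u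
    onto u ju with clique-neighbour j u ju
    ... | inj₁ ju-outer = zero , sym (outer⇒w u ju-outer)
    ... | inj₂ (k , eq) = suc k , eq

  clique-in-K-covers-K : (f : Fin (2 + m) → Fin n) → Injective _≡_ _≡_ f → (∀ γ → InK (f γ)) →
    ∀ k → ∃ λ γ → f γ ≡ v k
  clique-in-K-covers-K f f-inj f⊆K k with any? (λ γ → f γ ≟ v k)
  ... | yes hit = hit
  ... | no ¬hit = contradiction (injective-into-image-avoiding⇒< v f-inj relabel) (n≮n _)
    where
    relabel : ∀ γ → ∃ λ κ → κ ≢ k × v κ ≡ f γ
    relabel γ with f⊆K γ
    ... | κ , vκ≡fγ = κ , (λ { refl → ¬hit (γ , sym vκ≡fγ) }) , vκ≡fγ

  -- {w} ∪ K ∖ {v d, v e} is the image of K[ d ≔ w ] without v e.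
  no-clique-in-w∪K∖de : ∀ {w d e} → d ≢ e → (f : Fin (2 + m) → Fin n) → Injective _≡_ _≡_ f →
    ¬ (∀ γ → f γ ≡ w ⊎ ∃ λ k → v k ≡ f γ × k ≢ d × k ≢ e)
  no-clique-in-w∪K∖de {w} {d} {e} d≢e f f-inj f⊆ =
    n≮n _ (injective-into-image-avoiding⇒< K[ d ≔ w ] {e = suc (punchOut d≢e)} f-inj relabel)
    where
    relabel : ∀ γ → ∃ λ κ → κ ≢ suc (punchOut d≢e) × K[ d ≔ w ] κ ≡ f γ
    relabel γ with f⊆ γ
    ... | inj₁ fγ≡w = zero , (λ ()) , sym fγ≡w
    ... | inj₂ (k , vk≡fγ , k≢d , k≢e) =
      suc (punchOut (k≢d ∘ sym)) , k≢e ∘ punchOut-injective (k≢d ∘ sym) d≢e ∘ suc-injective ,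
      trans (cong v (punchIn-punchOut (k≢d ∘ sym))) vk≡fγ

  walk-into-K : ∀ {P x y} → Walk G P x y → ¬ InK x → InK y → ∃₂ λ k u → P (v k) × Outer k u
  walk-into-K walk x∉K y∈K with walk-exit G (¬? ∘ InK?) walk x∉K (λ y∉K → y∉K y∈K)
  ... | a , b , Pb , a∉K , ¬b∉K , ab with decidable-stable (InK? b) ¬b∉K
  ...   | k , refl = k , a , Pb , E-sym G ab , a∉K

  outer-exists : Connected G → 2 + m < n → ∃₂ Outer
  outer-exists connected 2+m<n with <⇒∃-unhit v 2+m<n
  ... | x , x∉K with walk-into-K (connected x (v zero)) (uncurry x∉K) (zero , refl)
  ...   | k , u , _ , ku = k , u , ku

  outer-dichotomy : Connected G → 2 + m < n →
      (∃₂ λ i u → Outer i u × (∀ j → j ≢ i → ∀ u → ¬ Outer j u))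
    ⊎ (∃₂ λ i w → Outer i w × (∀ k u → Outer k u → u ≡ w))
  outer-dichotomy connected 2+m<n with outer-exists connected 2+m<n
  ... | i , u , iu with any? (λ j → ¬? (j ≟ i) ×-dec any? (Outer? j))
  ...   | no ∄j = inj₁ (i , u , iu , λ j j≢i u' ju' → ∄j (j , j≢i , u' , ju'))
  ...   | yes (j , j≢i , u' , ju') = inj₂ (i , u , iu , outer⇒u)
    where
    outer⇒u : ∀ k x → Outer k x → x ≡ u
    outer⇒u k x kx with k ≟ i
    ... | yes refl = trans (outer-unique (j≢i ∘ sym) kx ju') (outer-unique j≢i ju' iu)
    ... | no k≢i = outer-unique k≢i kx iu

  only-outer⇒cut-vertex : Connected G → (∃₂ λ i u → Outer i u × (∀ j → j ≢ i → ∀ u → ¬ Outer j u)) →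
    Σ (Fin (2 + m)) λ i → CutVertex G (v i) × (∀ j → j ≢ i → degree G (v j) ≡ suc m)
  only-outer⇒cut-vertex connected (i , u , (_ , u∉K) , only-i) =
    i , (u , v j , (λ u≡vi → u∉K (i , sym u≡vi)) , j≢i ∘ v-injective , connected u (v j) , no-detour) ,
    λ k k≢i → degree-without-outer k (only-i k k≢i)
    where
    j : Fin (2 + m)
    j = punchIn i zero
    j≢i : j ≢ i
    j≢i = punchInᵢ≢i i zero
    no-detour : ¬ Walk G (_≢ v i) u (v j)
    no-detour walk with walk-into-K walk u∉K (j , refl)
    ... | k , u' , vk≢vi , ku' = only-i k (vk≢vi ∘ cong v) u' ku'

  module SingleOuter {i w} (iw : Outer i w) (outer⇒w : ∀ k u → Outer k u → u ≡ w) where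

    w∉K : ¬ InK w
    w∉K = proj₂ iw

    nonneighbour-no-outer : ∀ {j} → ¬ E G w (v j) → ∀ u → ¬ Outer j u
    nonneighbour-no-outer {j} ¬wj u ju = ¬wj (E-sym G (subst (E G (v j)) (outer⇒w j u ju) (proj₁ ju)))

    K[≔w]-clique : ∀ c → (∀ k → k ≢ c → E G w (v k)) → ∀ γ δ → γ ≢ δ → E G (K[ c ≔ w ] γ) (K[ c ≔ w ] δ)
    K[≔w]-clique c w~ zero zero γ≢δ = contradiction refl γ≢δ
    K[≔w]-clique c w~ zero (suc l) _ = w~ (punchIn c l) (punchInᵢ≢i c l)
    K[≔w]-clique c w~ (suc k) zero _ = E-sym G (w~ (punchIn c k) (punchInᵢ≢i c k))
    K[≔w]-clique c w~ (suc k) (suc l) k≢l =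
      v-clique (punchIn c k) (punchIn c l) (k≢l ∘ cong suc ∘ punchIn-injective c k l)

    -- A walk from a vertex outside K ∪ {w} enters K ∪ {w} at w, from some a, since every outer
    -- neighbour of K is w. If w saw all of K but v c, then K[ c ≔ w ] with pendants v c and a is a virus.
    not-almost-all-adjacent : Connected G → 3 + m < n → ∀ c → ¬ (∀ k → k ≢ c → E G w (v k))
    not-almost-all-adjacent connected 3+m<n c w~ with <⇒∃-unhit (w ∷ v) 3+m<n
    ... | x , x∉wK
      with walk-exit G (λ u → all? (λ κ → ¬? ((w ∷ v) κ ≟ u))) (connected x w) x∉wK (λ w∉ → w∉ zero refl)
    ...   | a , b , _ , a∉wK , ¬b∉wK , ab with InK? b
    ...     | yes (k , refl) = a∉wK zero (sym (outer⇒w k a (E-sym G ab , uncurry (a∉wK ∘ suc))))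
    ...     | no b∉K with b ≟ w
    ...       | no b≢w = ¬b∉wK λ { zero w≡b → b≢w (sym w≡b) ; (suc k) vk≡b → b∉K (k , vk≡b) }
    ...       | yes refl = virus-free
      (K[ c ≔ w ] , K[≔]-injective c w∉K , K[≔w]-clique c w~ , v c , a , suc zero , zero , a∉wK (suc c) , (λ ()) ,
       (λ { zero w≡vc → w∉K (c , sym w≡vc) ; (suc k) → punchInᵢ≢i c k ∘ v-injective }) ,
       (λ { zero → a∉wK zero ; (suc k) → a∉wK (suc (punchIn c k)) }) ,
       adjacent-punchIn c zero , ab)

    two-nonneighbours : Connected G → 3 + m < n → ∃₂ λ c d → c ≢ d × ¬ E G w (v c) × ¬ E G w (v d)
    two-nonneighbours connected 3+m<n =
      two-counterexamples (λ k → adj G w (v k) ≟ᵇ true) (not-almost-all-adjacent connected 3+m<n)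

    module ThreeNonneighbours {c d e} (c≢d : c ≢ d) (c≢e : c ≢ e) (d≢e : d ≢ e)
      (¬wc : ¬ E G w (v c)) (¬wd : ¬ E G w (v d)) (¬we : ¬ E G w (v e)) where

      w-neighbour-index : ∀ {k} → E G w (v k) → k ≢ d × k ≢ e
      w-neighbour-index wk = (λ { refl → ¬wd wk }) , (λ { refl → ¬we wk })

      vc-neighbour-in-K : ∀ {x} → E G (v c) x → InK x
      vc-neighbour-in-K {x} cx = decidable-stable (InK? x) λ x∉K → nonneighbour-no-outer ¬wc x (cx , x∉K)

      -- The other members of such a clique are adjacent to w, and those outside K would be outer
      -- neighbours of v k, i.e. w again; so the clique lies in {w} ∪ K ∖ {v d, v e}.
      no-clique-through-w : (f : Fin (2 + m) → Fin n) → Injective _≡_ _≡_ f →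
        ∀ {α β k} → α ≢ β → f α ≡ w → f β ≡ v k → k ≢ d → k ≢ e →
        ¬ (∀ γ → γ ≢ α → γ ≢ β → E G (f γ) w × E G (f γ) (v k))
      no-clique-through-w f f-inj {α} {β} {k} α≢β fα≡w fβ≡vk k≢d k≢e adjacent =
        no-clique-in-w∪K∖de d≢e f f-inj place
        where
        place : ∀ γ → f γ ≡ w ⊎ ∃ λ k' → v k' ≡ f γ × k' ≢ d × k' ≢ e
        place γ with γ ≟ α | γ ≟ β
        ... | yes refl | _ = inj₁ fα≡w
        ... | no _ | yes refl = inj₂ (k , sym fβ≡vk , k≢d , k≢e)
        ... | no γ≢α | no γ≢β with adjacent γ γ≢α γ≢β | InK? (f γ)
        ...   | γw , _ | yes (k' , vk'≡fγ) =
          inj₂ (k' , vk'≡fγ , w-neighbour-index (E-sym G (subst (λ z → E G z w) (sym vk'≡fγ) γw)))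
        ...   | _ , γk | no fγ∉K =
          ⊥-elim (γ≢α (f-inj (trans (outer⇒w k (f γ) (E-sym G γk , fγ∉K)) (sym fα≡w))))

      Added : Fin n → Fin n → Set
      Added x y = (x ≡ w × y ≡ v c) ⊎ (x ≡ v c × y ≡ w)

      module _ (f : Fin (2 + m) → Fin n) (f-inj : Injective _≡_ _≡_ f)
        (f-clique : ∀ γ δ → γ ≢ δ → E G (f γ) (f δ)) {q b} (f≢q : ∀ γ → f γ ≢ q) (qb : E G q (f b)) where

        through-vc⇒in-K : ∀ {a} → f a ≡ v c → ∀ γ → InK (f γ)
        through-vc⇒in-K {a} fa≡vc γ with γ ≟ a
        ... | yes refl = c , sym fa≡vc
        ... | no γ≢a = vc-neighbour-in-K (subst (λ z → E G z (f γ)) fa≡vc (f-clique a γ (γ≢a ∘ sym)))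

        no-pendant-w-at-vc : ∀ {a} → f a ≡ v c → q ≢ w → ⊥
        no-pendant-w-at-vc fa≡vc q≢w with InK? q | through-vc⇒in-K fa≡vc b
        ... | yes (k , vk≡q) | _ with clique-in-K-covers-K f f-inj (through-vc⇒in-K fa≡vc) k
        ...   | γ , fγ≡vk = f≢q γ (trans fγ≡vk vk≡q)
        no-pendant-w-at-vc fa≡vc q≢w | no q∉K | k , vk≡fb =
          q≢w (outer⇒w k q (E-sym G (subst (E G q) (sym vk≡fb) qb) , q∉K))

        -- If f b ∉ K, then v i (adjacent to w = f a) can replace v c as the pendant at w.
        no-pendant-vc-at-w : ∀ {a} → a ≢ b → f a ≡ w → ⊥
        no-pendant-vc-at-w {a} a≢b fa≡w with InK? (f b)
        ... | yes (k , vk≡fb) = no-clique-through-w f f-inj a≢b fa≡w (sym vk≡fb) k≢d k≢e adjacent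
          where
          wk : E G w (v k)
          wk = subst₂ (E G) fa≡w (sym vk≡fb) (f-clique a b a≢b)
          k≢d : k ≢ d
          k≢d = proj₁ (w-neighbour-index wk)
          k≢e : k ≢ e
          k≢e = proj₂ (w-neighbour-index wk)
          adjacent : ∀ γ → γ ≢ a → γ ≢ b → E G (f γ) w × E G (f γ) (v k)
          adjacent γ γ≢a γ≢b =
            subst (E G (f γ)) fa≡w (f-clique γ a γ≢a) , subst (E G (f γ)) (sym vk≡fb) (f-clique γ b γ≢b)
        ... | no fb∉K = virus-free
          (f , (λ {_} {_} → f-inj) , f-clique , v i , q , a , b , vi≢q , a≢b , f≢vi , f≢q ,
           subst (E G (v i)) (sym fa≡w) (proj₁ iw) , qb)
          where
          ¬vi-fb : ¬ E G (v i) (f b)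
          ¬vi-fb i-fb = a≢b (f-inj (trans fa≡w (sym (outer⇒w i (f b) (i-fb , fb∉K)))))
          vi≢q : v i ≢ q
          vi≢q vi≡q = ¬vi-fb (subst (λ z → E G z (f b)) (sym vi≡q) qb)
          f≢vi : ∀ γ → f γ ≢ v i
          f≢vi γ fγ≡vi with γ ≟ b
          ... | yes refl = fb∉K (i , sym fγ≡vi)
          ... | no γ≢b = ¬vi-fb (subst (λ z → E G z (f b)) fγ≡vi (f-clique γ b γ≢b))

        no-added-pendant : ∀ {p a} → a ≢ b → q ≢ p → Added p (f a) → ⊥
        no-added-pendant _ q≢p (inj₁ (p≡w , fa≡vc)) = no-pendant-w-at-vc fa≡vc (λ q≡w → q≢p (trans q≡w (sym p≡w)))
        no-added-pendant a≢b _ (inj₂ (_ , fa≡w)) = no-pendant-vc-at-w a≢b fa≡w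

      added-twice : ∀ {p q x y} → p ≢ q → Added p x → Added q y → y ≡ p
      added-twice p≢q (inj₁ (p≡w , _)) (inj₁ (q≡w , _)) = contradiction (trans p≡w (sym q≡w)) p≢q
      added-twice _ (inj₁ (p≡w , _)) (inj₂ (_ , y≡w)) = trans y≡w (sym p≡w)
      added-twice _ (inj₂ (p≡vc , _)) (inj₁ (_ , y≡vc)) = trans y≡vc (sym p≡vc)
      added-twice p≢q (inj₂ (p≡vc , _)) (inj₂ (q≡vc , _)) = contradiction (trans p≡vc (sym q≡vc)) p≢q

      no-virus : ¬ ContainsVirus (2 + m) (E+ G w (v c))
      no-virus (f , f-inj , f-clique , p , q , a , b , p≢q , a≢b , f≢p , f≢q , pa , qb)
        with any? (λ α → f α ≟ w) ×-dec any? (λ β → f β ≟ v c)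
      ... | yes ((α , fα≡w) , (β , fβ≡vc)) = no-clique-through-w f f-inj α≢β fα≡w fβ≡vc c≢d c≢e adjacent
        where
        α≢β : α ≢ β
        α≢β refl = w∉K (c , trans (sym fβ≡vc) fα≡w)
        adjacent : ∀ γ → γ ≢ α → γ ≢ β → E G (f γ) w × E G (f γ) (v c)
        adjacent γ γ≢α γ≢β =
          E+-old G fγ≢w fγ≢vc (subst (E+ G w (v c) (f γ)) fα≡w (f-clique γ α γ≢α)) ,
          E+-old G fγ≢w fγ≢vc (subst (E+ G w (v c) (f γ)) fβ≡vc (f-clique γ β γ≢β))
          where
          fγ≢w : f γ ≢ w
          fγ≢w fγ≡w = γ≢α (f-inj (trans fγ≡w (sym fα≡w)))
          fγ≢vc : f γ ≢ v c
          fγ≢vc fγ≡vc = γ≢β (f-inj (trans fγ≡vc (sym fβ≡vc)))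
      ... | no ¬both = pendants pa qb
        where
        old-clique : ∀ γ δ → γ ≢ δ → E G (f γ) (f δ)
        old-clique γ δ γ≢δ with f-clique γ δ γ≢δ
        ... | inj₁ γδ = γδ
        ... | inj₂ (inj₁ (fγ≡w , fδ≡vc)) = ⊥-elim (¬both ((γ , fγ≡w) , (δ , fδ≡vc)))
        ... | inj₂ (inj₂ (fγ≡vc , fδ≡w)) = ⊥-elim (¬both ((δ , fδ≡w) , (γ , fγ≡vc)))
        pendants : E+ G w (v c) p (f a) → E+ G w (v c) q (f b) → ⊥
        pendants (inj₁ pa) (inj₁ qb) =
          virus-free (f , f-inj , old-clique , p , q , a , b , p≢q , a≢b , f≢p , f≢q , pa , qb)
        pendants (inj₂ pa) (inj₁ qb) = no-added-pendant f f-inj old-clique f≢q qb a≢b (p≢q ∘ sym) pa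
        pendants (inj₁ pa) (inj₂ qb) = no-added-pendant f f-inj old-clique f≢p pa (a≢b ∘ sym) p≢q qb
        pendants (inj₂ pa) (inj₂ qb) = f≢p b (added-twice p≢q pa qb)

    two-low-degrees : Connected G → 3 + m < n →
      (∀ x y → x ≢ y → ¬ E G x y → ContainsVirus (2 + m) (E+ G x y)) →
      Σ (Fin (2 + m)) λ c → Σ (Fin (2 + m)) λ d → c ≢ d
        × degree G (v c) ≡ suc m × degree G (v d) ≡ suc m
        × (∀ k → k ≢ c → k ≢ d → degree G (v k) ≡ 2 + m)
        × Σ (Fin n) λ w' → (∀ k → v k ≢ w') × (∀ k → k ≢ c → k ≢ d → E G w' (v k))
    two-low-degrees connected 3+m<n saturating with two-nonneighbours connected 3+m<n
    ... | c , d , c≢d , ¬wc , ¬wd =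
      c , d , c≢d ,
      degree-without-outer c (nonneighbour-no-outer ¬wc) , degree-without-outer d (nonneighbour-no-outer ¬wd) ,
      (λ k k≢c k≢d → degree-single-outer k w (E-sym G (w~ k k≢c k≢d) , w∉K) (outer⇒w k)) ,
      w , curry w∉K , w~
      where
      w~ : ∀ k → k ≢ c → k ≢ d → E G w (v k)
      w~ k k≢c k≢d = decidable-stable (adj G w (v k) ≟ᵇ true) λ ¬wk →
        ThreeNonneighbours.no-virus c≢d (k≢c ∘ sym) (k≢d ∘ sym) ¬wc ¬wd ¬wk
          (saturating w (v c) (λ w≡vc → w∉K (c , sym w≡vc)) ¬wc)

-- The argument only needs t ≥ 2.
proposition2p1 : (t : ℕ) → 4 ≤ t → (n : ℕ) → (G : Graph n) → Connected G → Saturated t G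
    → (v : Fin t → Fin n) → Injective _≡_ _≡_ v → (∀ i j → i ≢ j → E G (v i) (v j))
    → (Σ (Fin t) λ i → CutVertex G (v i) × (∀ j → j ≢ i → degree G (v j) ≡ t ∸ 1))
      ⊎ (Σ (Fin t) λ i → Σ (Fin t) λ j → i ≢ j
          × degree G (v i) ≡ t ∸ 1 × degree G (v j) ≡ t ∸ 1
          × (∀ k → k ≢ i → k ≢ j → degree G (v k) ≡ t)
          × Σ (Fin n) λ w → (∀ k → v k ≢ w) × (∀ k → k ≢ i → k ≢ j → E G w (v k)))
proposition2p1 (suc (suc m)) (s≤s (s≤s _)) n G connected (size , virus-free , saturating) v v-injective v-clique =
  Sum.map (only-outer⇒cut-vertex connected)
          (λ (_ , _ , iw , outer⇒w) → SingleOuter.two-low-degrees iw outer⇒w connected 3+m<n saturating)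
          (outer-dichotomy connected (<⇒≤ 3+m<n))
  where
  open Clique G v v-injective v-clique virus-free
  3+m<n : 3 + m < n
  3+m<n = subst (_≤ n) (cong (2 +_) (+-comm m 2)) size
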